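{- Let $\mathbb{I}$ be the set of odd positive integers. Then $$\mathbb{I}\setminus\mathfrak{P}=\bigcup_{p\ge 3,\ p \text{ prime}}\mathcal{F}_p,$$ where for an odd prime $p$, $\mathcal{F}_p$ is the set of positive integers $n$ with $n\equiv p^2\pmod{2p(p-1)}$.
   Context: For an odd positive integer $n$, put $G(n)=\sum_{j=1}^{n-1} j^{(n-1)/2}$. Let $\mathfrak{P}$ denote the set of odd positive integers $n$ such that $G(n)\equiv 0\pmod n$. -}

module Defs where

open import Data.Nat using (ℕ; zero; suc; _+_; _*_; _∸_; _^_; _≤_; _<_; _/_; _%_)
open import Data.Nat.Divisibility using (_∣_)
open import Data.Nat.Primality using (Prime)
open import Data.List using (map; upTo)
open import Data.Nat.ListAction using (sum)
open import Data.Product using (_×_; ∃-syntax)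
open import Relation.Nullary using (¬_)
open import Relation.Binary.PropositionalEquality using (_≡_)

Odd : ℕ → Set
Odd n = n % 2 ≡ 1

-- G(n) = Σ_{j=1}^{n-1} j^((n-1)/2)   (upTo n = [0,…,n-1]; the j = 0 term is 0^k,
-- which we exclude by summing over suc of upTo (n ∸ 1))
G : ℕ → ℕ
G n = sum (map (λ j → suc j ^ ((n ∸ 1) / 2)) (upTo (n ∸ 1)))

InP : ℕ → Set
InP n = Odd n × 0 < n × n ∣ G n

InI : ℕ → Set
InI n = Odd n × 0 < n

open import Data.Sum using (_⊎_)
_≡_[mod_] : ℕ → ℕ → ℕ → Set
a ≡ b [mod m ] = (∃[ k ] a + k * m ≡ b) ⊎ (∃[ k ] b + k * m ≡ a)

InF : ℕ → ℕ → Set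
InF p n = 0 < n × n ≡ p * p [mod 2 * p * (p ∸ 1) ]

module Submission where

-- Write n = 2K + 1.  For n = 1 the claim is trivial, and for K > 0 the sum G(n) is the power
-- sum S_K(n) = ∑_{j<n} j^K.  The proof determines S_K(n) modulo every prime power dividing n:
--   * Pascal's identity for power sums and Fermat's little theorem give, for a prime p,
--     S_K(p) ≡ 0 (mod p) if (p - 1) ∤ K, and S_K(p) ≡ p - 1 (mod p) if (p - 1) ∣ K;
--   * periodicity S_K(c·d) ≡ c·S_K(d) (mod d) together with a lifting lemma for odd p,
--     S_K(p·M) ≡ p·S_K(M) (mod p·M) when p ∣ M, give S_K(p^(e+1)) ≡ p^e·S_K(p) (mod p^(e+1)).
-- Call a prime p ∣ n with (p - 1) ∣ K a witness.  If n = c·p^(e+1) with p ∤ c and p is a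
-- witness, then S_K(n) ≡ c·p^e·(p - 1) ≢ 0 (mod p^(e+1)), so n ∉ 𝔓.  Without a witness every
-- prime power dividing n divides G(n), hence n ∣ G(n) by a local-to-global argument.
-- Finally, for an odd prime p the odd n having p as a witness are exactly n ≡ p² (mod 2p(p - 1)).

open import Defs
open import Data.Nat using (ℕ; _≤_)
open import Data.Nat.Primality using (Prime)
open import Data.Product using (_×_; ∃-syntax)
open import Relation.Nullary using (¬_)
open import Function.Bundles using (_⇔_)

open import Data.Product using (_,_)
open import Data.Sum using (_⊎_; inj₁; inj₂; [_,_]′)
open import Data.Empty using (⊥-elim)
open import Relation.Binary.PropositionalEquality
  using (_≡_; refl; sym; trans; cong; cong₂; subst; subst₂; module ≡-Reasoning)

module PowerSums where

  open import Data.Nat as ℕ using (zero; suc; s≤s; z≤n)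
  import Data.Nat.Properties as ℕₚ
  open import Data.Nat.Divisibility using (_∣_; divides; >⇒∤; m%n≡0⇒n∣m; *-cancelˡ-∣)
  open import Data.Integer using (ℤ; +_; -[1+_]; 0ℤ; 1ℤ; ∣_∣; _+_; _*_; _-_; -_; _^_)
  open import Data.Integer.Properties
    using (+-identityˡ; +-identityʳ; *-identityˡ; *-identityʳ; *-zeroʳ; pos-+; pos-*;
           abs-*; neg-distribˡ-*; *-comm; +-assoc; *-assoc; ^-distribˡ-+-*; ^-*-assoc; ^-zeroˡ; *-cancelˡ-≡)
  open import Data.Integer.Tactic.RingSolver using (solve-∀)
  open import Data.Nat.Tactic.RingSolver renaming (solve-∀ to ℕ-solve-∀)
  open import Data.List using (map; applyUpTo)
  open import Data.Nat.ListAction using (sum)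
  open import Data.Nat.Primality using (euclidsLemma)
  open import Data.Nat.Induction using (<-rec)
  open import Data.Nat.DivMod using (_/_; _%_; m≡m%n+[m/n]*n; m%n<n; m*n/n≡m)
  open import Relation.Binary.Bundles using (Setoid)
  import Relation.Binary.Reasoning.Setoid as SetoidReasoning

  -- Congruence of integers modulo m, carrying the explicit quotient so that
  -- every congruence step is an equation the ring solver can check.
  infix 4 _≋_mod_
  record _≋_mod_ (a b m : ℤ) : Set where
    constructor mk≋
    field
      quotient : ℤ
      equation : a ≡ b + quotient * m

  ≋-refl : ∀ {m} a → a ≋ a mod m
  ≋-refl {m} a = mk≋ 0ℤ (identity a m)
    where
    identity : ∀ a m → a ≡ a + 0ℤ * m
    identity = solve-∀

  ≡⇒≋ : ∀ {m a b} → a ≡ b → a ≋ b mod m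
  ≡⇒≋ {b = b} refl = ≋-refl b

  ≋-sym : ∀ {m a b} → a ≋ b mod m → b ≋ a mod m
  ≋-sym {m} {b = b} (mk≋ q refl) = mk≋ (- q) (identity b q m)
    where
    identity : ∀ b q m → b ≡ (b + q * m) + (- q) * m
    identity = solve-∀

  ≋-trans : ∀ {m a b c} → a ≋ b mod m → b ≋ c mod m → a ≋ c mod m
  ≋-trans {m} {c = c} (mk≋ q refl) (mk≋ r refl) = mk≋ (q + r) (identity c q r m)
    where
    identity : ∀ c q r m → (c + r * m) + q * m ≡ c + (q + r) * m
    identity = solve-∀

  ≋-+ : ∀ {m a b c d} → a ≋ b mod m → c ≋ d mod m → a + c ≋ b + d mod m
  ≋-+ {m} {b = b} {d = d} (mk≋ q refl) (mk≋ r refl) = mk≋ (q + r) (identity b d q r m)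
    where
    identity : ∀ b d q r m → (b + q * m) + (d + r * m) ≡ (b + d) + (q + r) * m
    identity = solve-∀

  ≋-* : ∀ {m a b c d} → a ≋ b mod m → c ≋ d mod m → a * c ≋ b * d mod m
  ≋-* {m} {b = b} {d = d} (mk≋ q refl) (mk≋ r refl) =
    mk≋ (q * d + b * r + q * r * m) (identity b d q r m)
    where
    identity : ∀ b d q r m →
      (b + q * m) * (d + r * m) ≡ b * d + (q * d + b * r + q * r * m) * m
    identity = solve-∀

  ≋-neg : ∀ {m a b} → a ≋ b mod m → - a ≋ - b mod m
  ≋-neg {m} {b = b} (mk≋ q refl) = mk≋ (- q) (identity b q m)
    where
    identity : ∀ b q m → - (b + q * m) ≡ - b + (- q) * m
    identity = solve-∀

  ≋-scale : ∀ {m a b} c → a ≋ b mod m → c * a ≋ c * b mod c * m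
  ≋-scale {m} {b = b} c (mk≋ q refl) = mk≋ q (identity c b q m)
    where
    identity : ∀ c b q m → c * (b + q * m) ≡ c * b + q * (c * m)
    identity = solve-∀

  ≋-weaken : ∀ {m t a b} → a ≋ b mod m * t → a ≋ b mod m
  ≋-weaken {m} {t} {b = b} (mk≋ q refl) = mk≋ (q * t) (identity b q m t)
    where
    identity : ∀ b q m t → b + q * (m * t) ≡ b + (q * t) * m
    identity = solve-∀

  ≋-multiple : ∀ {m} b q → b + q * m ≋ b mod m
  ≋-multiple b q = mk≋ q refl

  ≋-^ : ∀ {m a b} k → a ≋ b mod m → a ^ k ≋ b ^ k mod m
  ≋-^ zero a≋b = ≋-refl 1ℤ
  ≋-^ (suc k) a≋b = ≋-* a≋b (≋-^ k a≋b)

  ≋-modulus : ∀ {m m′ a b} → m ≡ m′ → a ≋ b mod m → a ≋ b mod m′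
  ≋-modulus refl a≋b = a≋b

  ≋-setoid : ℤ → Setoid _ _
  ≋-setoid m = record
    { Carrier = ℤ ; _≈_ = λ a b → a ≋ b mod m
    ; isEquivalence = record { refl = ≋-refl _ ; sym = ≋-sym ; trans = ≋-trans } }

  module ≋-Reasoning (m : ℤ) = SetoidReasoning (≋-setoid m)

  infix 4 _∣ℤ_
  _∣ℤ_ : ℕ → ℤ → Set
  p ∣ℤ a = a ≋ 0ℤ mod + p

  ∣ℤ⇒∣ : ∀ {p a} → p ∣ℤ a → p ∣ ∣ a ∣
  ∣ℤ⇒∣ {p} {a} (mk≋ q a≡q*p) =
    divides ∣ q ∣ (trans (cong ∣_∣ (trans a≡q*p (+-identityˡ (q * + p)))) (abs-* q (+ p)))

  ∣⇒∣ℤ : ∀ {p} a → p ∣ ∣ a ∣ → p ∣ℤ a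
  ∣⇒∣ℤ {p} (+ n) (divides c refl) = mk≋ (+ c) (trans (pos-* c p) (sym (+-identityˡ _)))
  ∣⇒∣ℤ {p} -[1+ n ] (divides c eq) = mk≋ (- + c) (begin
    -[1+ n ]            ≡⟨ cong (λ v → - (+ v)) eq ⟩
    - (+ (c ℕ.* p))     ≡⟨ cong -_ (pos-* c p) ⟩
    - (+ c * + p)       ≡⟨ neg-distribˡ-* (+ c) (+ p) ⟩
    - + c * + p         ≡⟨ +-identityˡ _ ⟨
    0ℤ + - + c * + p    ∎)
    where open ≡-Reasoning

  ∣ℤ-refl : ∀ p → p ∣ℤ + p
  ∣ℤ-refl p = mk≋ 1ℤ (sym (trans (+-identityˡ _) (*-identityˡ (+ p))))

  ∣ℤ-*ˡ : ∀ {p a} c → p ∣ℤ a → p ∣ℤ c * a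
  ∣ℤ-*ˡ c p∣a = ≋-trans (≋-* (≋-refl c) p∣a) (≡⇒≋ (*-zeroʳ c))

  ∣ℤ-*ʳ : ∀ {p a} c → p ∣ℤ a → p ∣ℤ a * c
  ∣ℤ-*ʳ {a = a} c p∣a = ≋-trans (≡⇒≋ (*-comm a c)) (∣ℤ-*ˡ c p∣a)

  euclidℤ : ∀ {p} a b → Prime p → p ∣ℤ a * b → p ∣ℤ a ⊎ p ∣ℤ b
  euclidℤ a b pr p∣ab
    with euclidsLemma ∣ a ∣ ∣ b ∣ pr (subst (_ ∣_) (abs-* a b) (∣ℤ⇒∣ p∣ab))
  ... | inj₁ p∣a = inj₁ (∣⇒∣ℤ a p∣a)
  ... | inj₂ p∣b = inj₂ (∣⇒∣ℤ b p∣b)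

  ∣ℤ-difference⇒≋ : ∀ {p a b} → p ∣ℤ a - b → a ≋ b mod + p
  ∣ℤ-difference⇒≋ {p} {a} {b} (mk≋ q eq) = mk≋ q (begin
    a                  ≡⟨ identity a b ⟩
    b + (a - b)        ≡⟨ cong (_+_ b) (trans eq (+-identityˡ _)) ⟩
    b + q * + p        ∎)
    where
    open ≡-Reasoning
    identity : ∀ a b → a ≡ b + (a - b)
    identity = solve-∀

  ≋⇒∣ℤ-difference : ∀ {p a b} → a ≋ b mod + p → p ∣ℤ a - b
  ≋⇒∣ℤ-difference {p} {b = b} (mk≋ q refl) = mk≋ q (identity b q (+ p))
    where
    identity : ∀ b q m → (b + q * m) - b ≡ 0ℤ + q * m
    identity = solve-∀

  ∑ : ℕ → (ℕ → ℤ) → ℤ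
  ∑ zero f = 0ℤ
  ∑ (suc n) f = ∑ n f + f n

  infix 5 ∑
  syntax ∑ n (λ j → e) = ∑[ j < n ] e

  ∑-ext : ∀ {f g} n → (∀ j → j ℕ.< n → f j ≡ g j) → ∑ n f ≡ ∑ n g
  ∑-ext zero f≡g = refl
  ∑-ext (suc n) f≡g = cong₂ _+_ (∑-ext n (λ j j<n → f≡g j (ℕₚ.m<n⇒m<1+n j<n))) (f≡g n ℕₚ.≤-refl)

  ∑-cong : ∀ {m f g} n → (∀ j → j ℕ.< n → f j ≋ g j mod m) → ∑ n f ≋ ∑ n g mod m
  ∑-cong zero f≋g = ≋-refl 0ℤ
  ∑-cong (suc n) f≋g = ≋-+ (∑-cong n (λ j j<n → f≋g j (ℕₚ.m<n⇒m<1+n j<n))) (f≋g n ℕₚ.≤-refl)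

  ∣ℤ-∑ : ∀ {p f} n → (∀ j → j ℕ.< n → p ∣ℤ f j) → p ∣ℤ ∑ n f
  ∣ℤ-∑ zero p∣f = ≋-refl 0ℤ
  ∣ℤ-∑ (suc n) p∣f = ≋-+ (∣ℤ-∑ n (λ j j<n → p∣f j (ℕₚ.m<n⇒m<1+n j<n))) (p∣f n ℕₚ.≤-refl)

  ∑-+ : ∀ f g n → ∑[ j < n ] (f j + g j) ≡ ∑ n f + ∑ n g
  ∑-+ f g zero = refl
  ∑-+ f g (suc n) = trans (cong (_+ (f n + g n)) (∑-+ f g n)) (identity (∑ n f) (∑ n g) (f n) (g n))
    where
    identity : ∀ a b c d → (a + b) + (c + d) ≡ (a + c) + (b + d)
    identity = solve-∀

  ∑-scale : ∀ c f n → ∑[ j < n ] (c * f j) ≡ c * ∑ n f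
  ∑-scale c f zero = sym (*-zeroʳ c)
  ∑-scale c f (suc n) = trans (cong (_+ c * f n) (∑-scale c f n)) (identity c (∑ n f) (f n))
    where
    identity : ∀ c a b → c * a + c * b ≡ c * (a + b)
    identity = solve-∀

  ∑-const : ∀ a n → ∑[ j < n ] a ≡ + n * a
  ∑-const a zero = refl
  ∑-const a (suc n) = trans (cong (_+ a) (∑-const a n)) (identity (+ n) a)
    where
    identity : ∀ n a → n * a + a ≡ (1ℤ + n) * a
    identity = solve-∀

  ∑-head : ∀ f n → ∑ (suc n) f ≡ f 0 + (∑[ j < n ] f (suc j))
  ∑-head f zero = trans (+-identityˡ (f 0)) (sym (+-identityʳ (f 0)))
  ∑-head f (suc n) = trans (cong (_+ f (suc n)) (∑-head f n)) (+-assoc (f 0) _ _)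

  ∑-split : ∀ f M d → ∑ (M ℕ.+ d) f ≡ ∑ M f + (∑[ j < d ] f (M ℕ.+ j))
  ∑-split f M zero = trans (cong (λ n → ∑ n f) (ℕₚ.+-identityʳ M)) (sym (+-identityʳ (∑ M f)))
  ∑-split f M (suc d) = begin
    ∑ (M ℕ.+ suc d) f                                ≡⟨ cong (λ n → ∑ n f) (ℕₚ.+-suc M d) ⟩
    ∑ (M ℕ.+ d) f + f (M ℕ.+ d)                      ≡⟨ cong (_+ f (M ℕ.+ d)) (∑-split f M d) ⟩
    (∑ M f + (∑[ j < d ] f (M ℕ.+ j))) + f (M ℕ.+ d)   ≡⟨ +-assoc (∑ M f) _ _ ⟩
    ∑ M f + (∑[ j < suc d ] f (M ℕ.+ j))             ∎
    where open ≡-Reasoning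

  ∑-blocks : ∀ f c M → ∑ (c ℕ.* M) f ≡ ∑[ t < c ] ∑[ u < M ] f (t ℕ.* M ℕ.+ u)
  ∑-blocks f zero M = refl
  ∑-blocks f (suc c) M = begin
    ∑ (M ℕ.+ c ℕ.* M) f                                    ≡⟨ cong (λ n → ∑ n f) (ℕₚ.+-comm M (c ℕ.* M)) ⟩
    ∑ (c ℕ.* M ℕ.+ M) f                                    ≡⟨ ∑-split f (c ℕ.* M) M ⟩
    ∑ (c ℕ.* M) f + (∑[ u < M ] f (c ℕ.* M ℕ.+ u))         ≡⟨ cong (_+ (∑[ u < M ] f (c ℕ.* M ℕ.+ u))) (∑-blocks f c M) ⟩
    ∑[ t < suc c ] ∑[ u < M ] f (t ℕ.* M ℕ.+ u)            ∎
    where open ≡-Reasoning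

  ∑-swap : ∀ (F : ℕ → ℕ → ℤ) a b → ∑[ j < b ] ∑[ i < a ] F i j ≡ ∑[ i < a ] ∑[ j < b ] F i j
  ∑-swap F a zero = sym (trans (∑-const 0ℤ a) (*-zeroʳ (+ a)))
  ∑-swap F a (suc b) = trans (cong (_+ (∑[ i < a ] F i b)) (∑-swap F a b)) (sym (∑-+ (λ i → ∑[ j < b ] F i j) (λ i → F i b) a))

  gauss : ∀ M → + 2 * (∑[ t < suc M ] + t) ≡ + suc M * + M
  gauss zero = refl
  gauss (suc M) = begin
    + 2 * ((∑[ t < suc M ] + t) + + suc M)       ≡⟨ identity₁ (∑[ t < suc M ] + t) (+ suc M) ⟩
    + 2 * (∑[ t < suc M ] + t) + + 2 * + suc M   ≡⟨ cong (_+ + 2 * + suc M) (gauss M) ⟩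
    + suc M * + M + + 2 * + suc M             ≡⟨ identity₂ (+ M) ⟩
    + suc (suc M) * + suc M                   ∎
    where
    open ≡-Reasoning
    identity₁ : ∀ a b → + 2 * (a + b) ≡ + 2 * a + + 2 * b
    identity₁ = solve-∀
    identity₂ : ∀ m → (1ℤ + m) * m + + 2 * (1ℤ + m) ≡ (+ 2 + m) * (1ℤ + m)
    identity₂ = solve-∀

  ∑-odd-range : ∀ h → (∑[ t < suc (2 ℕ.* h) ] + t) ≡ + suc (2 ℕ.* h) * + h
  ∑-odd-range h = *-cancelˡ-≡ (+ 2) _ _ (begin
    + 2 * (∑[ t < suc (2 ℕ.* h) ] + t)   ≡⟨ gauss (2 ℕ.* h) ⟩
    + suc (2 ℕ.* h) * + (2 ℕ.* h)        ≡⟨ cong (+ suc (2 ℕ.* h) *_) (pos-* 2 h) ⟩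
    + suc (2 ℕ.* h) * (+ 2 * + h)        ≡⟨ identity (+ suc (2 ℕ.* h)) (+ h) ⟩
    + 2 * (+ suc (2 ℕ.* h) * + h)        ∎)
    where
    open ≡-Reasoning
    identity : ∀ a b → a * (+ 2 * b) ≡ + 2 * (a * b)
    identity = solve-∀

  sum-applyUpTo : ∀ (f g : ℕ → ℕ) m → + sum (map f (applyUpTo g m)) ≡ (∑[ j < m ] + f (g j))
  sum-applyUpTo f g zero = refl
  sum-applyUpTo f g (suc m) = begin
    + (f (g 0) ℕ.+ sum (map f (applyUpTo (λ j → g (suc j)) m)))   ≡⟨ pos-+ (f (g 0)) _ ⟩
    + f (g 0) + + sum (map f (applyUpTo (λ j → g (suc j)) m))     ≡⟨ cong (_+_ (+ f (g 0))) (sum-applyUpTo f (λ j → g (suc j)) m) ⟩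
    + f (g 0) + (∑[ j < m ] + f (g (suc j)))                        ≡⟨ ∑-head (λ j → + f (g j)) m ⟨
    ∑[ j < suc m ] + f (g j)                                        ∎
    where open ≡-Reasoning

  binom : ℕ → ℕ → ℕ
  binom n zero = 1
  binom zero (suc k) = 0
  binom (suc n) (suc k) = binom n k ℕ.+ binom n (suc k)

  binom-above : ∀ n k → n ℕ.< k → binom n k ≡ 0
  binom-above zero (suc k) _ = refl
  binom-above (suc n) (suc k) (s≤s n<k)
    rewrite binom-above n k n<k | binom-above n (suc k) (ℕₚ.m<n⇒m<1+n n<k) = refl

  binom-diag : ∀ n → binom n n ≡ 1
  binom-diag zero = refl
  binom-diag (suc n) rewrite binom-diag n | binom-above n (suc n) ℕₚ.≤-refl = refl

  binom-one : ∀ n → binom n 1 ≡ n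
  binom-one zero = refl
  binom-one (suc n) rewrite binom-one n = refl

  binom-subdiag : ∀ r → binom (suc r) r ≡ suc r
  binom-subdiag zero = refl
  binom-subdiag (suc r) rewrite binom-subdiag r | binom-diag r | binom-above r (suc r) ℕₚ.≤-refl =
    cong suc (ℕₚ.+-comm r 1)

  binom-absorb : ∀ n k → suc k ℕ.* binom (suc n) (suc k) ≡ suc n ℕ.* binom n k
  binom-absorb zero zero = refl
  binom-absorb zero (suc k) = ℕₚ.*-zeroʳ (suc (suc k))
  binom-absorb (suc n) zero =
    trans (ℕₚ.+-identityʳ _) (trans (binom-one (suc (suc n))) (sym (ℕₚ.*-identityʳ _)))
  binom-absorb (suc n) (suc k) = begin
    suc (suc k) ℕ.* (A ℕ.+ B)                                   ≡⟨ regroup k A B ⟩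
    A ℕ.+ (suc k ℕ.* A ℕ.+ suc (suc k) ℕ.* B)                   ≡⟨ cong₂ (λ u v → A ℕ.+ (u ℕ.+ v)) (binom-absorb n k) (binom-absorb n (suc k)) ⟩
    (a ℕ.+ b) ℕ.+ (suc n ℕ.* a ℕ.+ suc n ℕ.* b)                 ≡⟨ collect n a b ⟩
    suc (suc n) ℕ.* binom (suc n) (suc k)                       ∎
    where
    open ≡-Reasoning
    A : ℕ
    A = binom (suc n) (suc k)
    B : ℕ
    B = binom (suc n) (suc (suc k))
    a : ℕ
    a = binom n k
    b : ℕ
    b = binom n (suc k)
    regroup : ∀ k X Y → suc (suc k) ℕ.* (X ℕ.+ Y) ≡ X ℕ.+ (suc k ℕ.* X ℕ.+ suc (suc k) ℕ.* Y)
    regroup = ℕ-solve-∀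
    collect : ∀ n a b → (a ℕ.+ b) ℕ.+ (suc n ℕ.* a ℕ.+ suc n ℕ.* b) ≡ suc (suc n) ℕ.* (a ℕ.+ b)
    collect = ℕ-solve-∀

  prime∣binom : ∀ {p} i → Prime p → 0 ℕ.< i → i ℕ.< p → p ∣ binom p i
  prime∣binom {suc n} (suc k) pr _ i<p
    with euclidsLemma (suc k) (binom (suc n) (suc k)) pr
           (divides (binom n k) (trans (binom-absorb n k) (ℕₚ.*-comm (suc n) _)))
  ... | inj₂ p∣binom = p∣binom
  ... | inj₁ p∣i = ⊥-elim (>⇒∤ i<p p∣i)

  binomial : ∀ x n → (x + 1ℤ) ^ n ≡ ∑[ i < suc n ] (+ binom n i * x ^ i)
  binomial x zero = refl
  binomial x (suc n) = begin
    (x + 1ℤ) * (x + 1ℤ) ^ n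
      ≡⟨ cong ((x + 1ℤ) *_) (binomial x n) ⟩
    (x + 1ℤ) * ∑ (suc n) (T n)
      ≡⟨ distrib x (∑ (suc n) (T n)) ⟩
    x * ∑ (suc n) (T n) + ∑ (suc n) (T n)
      ≡⟨ cong₂ _+_ (sym (∑-scale x (T n) (suc n))) (∑-head (T n) n) ⟩
    (∑[ i < suc n ] x * T n i) + (1ℤ + (∑[ i < n ] T n (suc i)))
      ≡⟨ cong (λ t → (∑[ i < suc n ] x * T n i) + (1ℤ + t)) top-vanishes ⟩
    (∑[ i < suc n ] x * T n i) + (1ℤ + (∑[ i < suc n ] T n (suc i)))
      ≡⟨ regroup (∑[ i < suc n ] x * T n i) (∑[ i < suc n ] T n (suc i)) ⟩
    1ℤ + ((∑[ i < suc n ] x * T n i) + (∑[ i < suc n ] T n (suc i)))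
      ≡⟨ cong (_+_ 1ℤ) (∑-+ (λ i → x * T n i) (λ i → T n (suc i)) (suc n)) ⟨
    1ℤ + (∑[ i < suc n ] (x * T n i + T n (suc i)))
      ≡⟨ cong (_+_ 1ℤ) (∑-ext (suc n) (λ i _ → pascal i)) ⟩
    1ℤ + (∑[ i < suc n ] T (suc n) (suc i))
      ≡⟨ ∑-head (T (suc n)) (suc n) ⟨
    ∑ (suc (suc n)) (T (suc n))
      ∎
    where
    open ≡-Reasoning
    T : ℕ → ℕ → ℤ
    T n i = + binom n i * x ^ i
    distrib : ∀ x s → (x + 1ℤ) * s ≡ x * s + s
    distrib = solve-∀
    regroup : ∀ a b → a + (1ℤ + b) ≡ 1ℤ + (a + b)
    regroup = solve-∀
    top-vanishes : (∑[ i < n ] T n (suc i)) ≡ (∑[ i < suc n ] T n (suc i))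
    top-vanishes = begin
      (∑[ i < n ] T n (suc i))                                 ≡⟨ +-identityʳ _ ⟨
      (∑[ i < n ] T n (suc i)) + 0ℤ * x ^ suc n                ≡⟨ cong (λ c → (∑[ i < n ] T n (suc i)) + + c * x ^ suc n) (binom-above n (suc n) ℕₚ.≤-refl) ⟨
      (∑[ i < suc n ] T n (suc i))                             ∎
    pascal : ∀ i → x * T n i + T n (suc i) ≡ T (suc n) (suc i)
    pascal i = begin
      x * (+ binom n i * x ^ i) + + binom n (suc i) * (x * x ^ i)    ≡⟨ identity x (+ binom n i) (+ binom n (suc i)) (x ^ i) ⟩
      (+ binom n i + + binom n (suc i)) * (x * x ^ i)                 ≡⟨ cong (_* (x * x ^ i)) (pos-+ (binom n i) (binom n (suc i))) ⟨
      T (suc n) (suc i)                                               ∎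
      where
      identity : ∀ x a b w → x * (a * w) + b * (x * w) ≡ (a + b) * (x * w)
      identity = solve-∀

  -- Fermat's little theorem in the form xᵖ ≡ x (mod p), by induction on x:
  -- all middle binomial coefficients of (x + 1)ᵖ vanish modulo p.
  frobenius : ∀ {p} → Prime p → ∀ x → (+ x) ^ p ≋ + x mod + p
  frobenius {suc n} pr zero = ≋-refl 0ℤ
  frobenius {suc n} pr (suc x) = begin
    (+ suc x) ^ p                                 ≡⟨ cong (λ v → (+ v) ^ p) (ℕₚ.+-comm 1 x) ⟩
    (+ (x ℕ.+ 1)) ^ p                            ≡⟨ cong (_^ p) (pos-+ x 1) ⟩
    (+ x + 1ℤ) ^ p                               ≡⟨ binomial (+ x) p ⟩
    ∑ p T + T p                                  ≡⟨ cong (_+ T p) (∑-head T n) ⟩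
    (1ℤ + (∑[ i < n ] T (suc i))) + T p          ≈⟨ ≋-+ (≋-+ (≋-refl 1ℤ) middle-vanishes) last-term ⟩
    (1ℤ + 0ℤ) + + x                              ≡⟨ pos-+ 1 x ⟨
    + suc x                                      ∎
    where
    open ≋-Reasoning (+ suc n)
    p : ℕ
    p = suc n
    T : ℕ → ℤ
    T i = + binom p i * (+ x) ^ i
    middle-vanishes : p ∣ℤ (∑[ i < n ] T (suc i))
    middle-vanishes = ∣ℤ-∑ n (λ i i<n →
      ∣ℤ-*ʳ ((+ x) ^ suc i) (∣⇒∣ℤ (+ binom p (suc i)) (prime∣binom (suc i) pr (s≤s z≤n) (s≤s i<n))))
    last-term : T p ≋ + x mod + p
    last-term = ≋-trans (≡⇒≋ (trans (cong (λ c → + c * (+ x) ^ p) (binom-diag p)) (*-identityˡ _)))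
                        (frobenius pr x)

  fermat : ∀ {p} x → Prime p → ¬ p ∣ x → (+ x) ^ (p ℕ.∸ 1) ≋ 1ℤ mod + p
  fermat {suc n} x pr p∤x with euclidℤ (+ x) ((+ x) ^ n - 1ℤ) pr p∣x[xⁿ-1]
    where
    p∣x[xⁿ-1] : suc n ∣ℤ + x * ((+ x) ^ n - 1ℤ)
    p∣x[xⁿ-1] = ≋-trans (≡⇒≋ (expand (+ x) ((+ x) ^ n))) (≋⇒∣ℤ-difference (frobenius pr x))
      where
      expand : ∀ x w → x * (w - 1ℤ) ≡ x * w - x
      expand = solve-∀
  ... | inj₁ p∣x = ⊥-elim (p∤x (∣ℤ⇒∣ p∣x))
  ... | inj₂ p∣xⁿ-1 = ∣ℤ-difference⇒≋ p∣xⁿ-1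

  fermat-power : ∀ {p} x q → Prime p → ¬ p ∣ x → (+ x) ^ (q ℕ.* (p ℕ.∸ 1)) ≋ 1ℤ mod + p
  fermat-power {p} x q pr p∤x = begin
    (+ x) ^ (q ℕ.* (p ℕ.∸ 1))     ≡⟨ trans (cong (_^_ (+ x)) (ℕₚ.*-comm q _)) (sym (^-*-assoc (+ x) (p ℕ.∸ 1) q)) ⟩
    ((+ x) ^ (p ℕ.∸ 1)) ^ q       ≈⟨ ≋-^ q (fermat x pr p∤x) ⟩
    1ℤ ^ q                      ≡⟨ ^-zeroˡ q ⟩
    1ℤ                          ∎
    where open ≋-Reasoning (+ p)

  powerSum : ℕ → ℕ → ℤ
  powerSum r M = ∑[ j < M ] (+ j) ^ r

  -- Both sides arise from  ∑_{j < M} (j + 1)^(r+1), expanded once by the binomial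
  -- theorem and once by shifting the summation index.
  powerSum-pascal : ∀ r M → (∑[ i < suc r ] + binom (suc r) i * powerSum i M) ≡ (+ M) ^ suc r
  powerSum-pascal r M = cancel X (powerSum (suc r) M) ((+ M) ^ suc r) (trans (sym expand) shift)
    where
    open ≡-Reasoning
    X : ℤ
    X = ∑[ i < suc r ] + binom (suc r) i * powerSum i M
    g : ℕ → ℤ
    g j = (+ j) ^ suc r
    expand : (∑[ j < M ] g (suc j)) ≡ X + powerSum (suc r) M
    expand = begin
      (∑[ j < M ] g (suc j))
        ≡⟨ ∑-ext M (λ j _ → trans (cong (λ v → (+ v) ^ suc r) (ℕₚ.+-comm 1 j))
                                 (trans (cong (_^ suc r) (pos-+ j 1)) (binomial (+ j) (suc r)))) ⟩
      (∑[ j < M ] ∑[ i < suc (suc r) ] + binom (suc r) i * (+ j) ^ i)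
        ≡⟨ ∑-swap (λ i j → + binom (suc r) i * (+ j) ^ i) (suc (suc r)) M ⟩
      (∑[ i < suc (suc r) ] ∑[ j < M ] + binom (suc r) i * (+ j) ^ i)
        ≡⟨ ∑-ext (suc (suc r)) (λ i _ → ∑-scale (+ binom (suc r) i) (λ j → (+ j) ^ i) M) ⟩
      X + + binom (suc r) (suc r) * powerSum (suc r) M
        ≡⟨ cong (λ c → X + + c * powerSum (suc r) M) (binom-diag (suc r)) ⟩
      X + 1ℤ * powerSum (suc r) M
        ≡⟨ cong (_+_ X) (*-identityˡ _) ⟩
      X + powerSum (suc r) M
        ∎
    shift : (∑[ j < M ] g (suc j)) ≡ powerSum (suc r) M + (+ M) ^ suc r
    shift = trans (sym (+-identityˡ _)) (sym (∑-head g M))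
    cancel : ∀ x s y → x + s ≡ s + y → x ≡ y
    cancel x s y eq = trans (identity₁ x s) (trans (cong (_- s) eq) (identity₂ s y))
      where
      identity₁ : ∀ x s → x ≡ (x + s) - s
      identity₁ = solve-∀
      identity₂ : ∀ s y → (s + y) - s ≡ y
      identity₂ = solve-∀

  -- Newton's step: if p divides the power sums S_i(p) for all i < r, then it
  -- divides (r + 1) · S_r(p), which by Pascal's identity is p^(r+1) minus a
  -- combination of those lower power sums.
  powerSum-step : ∀ p r → (∀ i → i ℕ.< r → p ∣ℤ powerSum i p) → p ∣ℤ + suc r * powerSum r p
  powerSum-step p r lower-vanish = begin
    + suc r * powerSum r p
      ≡⟨ cong (λ c → + c * powerSum r p) (binom-subdiag r) ⟨
    + binom (suc r) r * powerSum r p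
      ≡⟨ isolate lower (+ binom (suc r) r * powerSum r p) ⟩
    (lower + + binom (suc r) r * powerSum r p) - lower
      ≡⟨ cong (_- lower) (powerSum-pascal r p) ⟩
    (+ p) ^ suc r - lower
      ≈⟨ ≋-+ p∣p^[r+1] (≋-neg p∣lower) ⟩
    0ℤ
      ∎
    where
    open ≋-Reasoning (+ p)
    lower : ℤ
    lower = ∑[ i < r ] + binom (suc r) i * powerSum i p
    p∣lower : p ∣ℤ lower
    p∣lower = ∣ℤ-∑ r (λ i i<r → ∣ℤ-*ˡ (+ binom (suc r) i) (lower-vanish i i<r))
    p∣p^[r+1] : p ∣ℤ (+ p) ^ suc r
    p∣p^[r+1] = ∣ℤ-*ʳ ((+ p) ^ r) (∣ℤ-refl p)
    isolate : ∀ a b → b ≡ (a + b) - a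
    isolate = solve-∀

  ∣ℤ-cancel : ∀ {p m} a → Prime p → suc m ℕ.< p → p ∣ℤ + suc m * a → p ∣ℤ a
  ∣ℤ-cancel {m = m} a pr m<p p∣ma with euclidℤ (+ suc m) a pr p∣ma
  ... | inj₁ p∣m = ⊥-elim (>⇒∤ m<p (∣ℤ⇒∣ p∣m))
  ... | inj₂ p∣a = p∣a

  powerSum-vanishes : ∀ {p} → Prime p → ∀ r → suc r ℕ.< p → p ∣ℤ powerSum r p
  powerSum-vanishes {p} pr = <-rec (λ r → suc r ℕ.< p → p ∣ℤ powerSum r p) λ r ih r+1<p →
    ∣ℤ-cancel (powerSum r p) pr r+1<p
      (powerSum-step p r (λ i i<r → ih i<r (ℕₚ.<-trans (s≤s i<r) r+1<p)))

  -- For K > 0 with (p - 1) ∤ K we have p ∣ S_K(p): reducing the exponent K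
  -- modulo p - 1 with Fermat leaves a power sum of exponent below p - 1.
  powerSum-prime-generic : ∀ {p} k → Prime p → ¬ (p ℕ.∸ 1) ∣ suc k → p ∣ℤ powerSum (suc k) p
  powerSum-prime-generic {suc (suc n)} k pr p-1∤K with suc k % suc n in K%[p-1]
  ... | zero = ⊥-elim (p-1∤K (m%n≡0⇒n∣m (suc k) (suc n) K%[p-1]))
  ... | suc r′ = ≋-trans (∑-cong p reduce) (powerSum-vanishes pr r (s≤s r<p-1))
    where
    p : ℕ
    p = suc (suc n)
    r : ℕ
    r = suc r′
    q : ℕ
    q = suc k / suc n
    K≡r+q[p-1] : suc k ≡ r ℕ.+ q ℕ.* suc n
    K≡r+q[p-1] = trans (m≡m%n+[m/n]*n (suc k) (suc n)) (cong (ℕ._+ q ℕ.* suc n) K%[p-1])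
    r<p-1 : r ℕ.< suc n
    r<p-1 = subst (ℕ._< suc n) K%[p-1] (m%n<n (suc k) (suc n))
    reduce : ∀ j → j ℕ.< p → (+ j) ^ suc k ≋ (+ j) ^ r mod + p
    reduce zero _ = ≋-refl 0ℤ
    reduce (suc j) j<p = begin
      (+ suc j) ^ suc k                           ≡⟨ cong (_^_ (+ suc j)) K≡r+q[p-1] ⟩
      (+ suc j) ^ (r ℕ.+ q ℕ.* suc n)             ≡⟨ ^-distribˡ-+-* (+ suc j) r (q ℕ.* suc n) ⟩
      (+ suc j) ^ r * (+ suc j) ^ (q ℕ.* suc n)   ≈⟨ ≋-* (≋-refl ((+ suc j) ^ r)) (fermat-power {p} (suc j) q pr (>⇒∤ j<p)) ⟩
      (+ suc j) ^ r * 1ℤ                          ≡⟨ *-identityʳ _ ⟩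
      (+ suc j) ^ r                               ∎
      where open ≋-Reasoning (+ p)

  -- For K > 0 with (p - 1) ∣ K every nonzero residue contributes 1, so S_K(p) ≡ p - 1.
  powerSum-prime-exceptional : ∀ {p} q k → Prime p → suc k ≡ q ℕ.* (p ℕ.∸ 1) →
                               powerSum (suc k) p ≋ + (p ℕ.∸ 1) mod + p
  powerSum-prime-exceptional {suc n} q k pr K≡q[p-1] = begin
    powerSum (suc k) (suc n)                 ≡⟨ trans (∑-head _ n) (+-identityˡ _) ⟩
    (∑[ j < n ] (+ suc j) ^ suc k)           ≈⟨ ∑-cong n (λ j j<n → ≋-trans (≡⇒≋ (cong (_^_ (+ suc j)) K≡q[p-1]))
                                                                    (fermat-power {suc n} (suc j) q pr (>⇒∤ (s≤s j<n)))) ⟩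
    (∑[ j < n ] 1ℤ)                          ≡⟨ trans (∑-const 1ℤ n) (*-identityʳ (+ n)) ⟩
    + n                                      ∎
    where open ≋-Reasoning (+ suc n)

  pos-block : ∀ t M u → + (t ℕ.* M ℕ.+ u) ≡ + u + + t * + M
  pos-block t M u = trans (cong +_ (ℕₚ.+-comm (t ℕ.* M) u)) (trans (pos-+ u (t ℕ.* M)) (cong (_+_ (+ u)) (pos-* t M)))

  -- Periodicity: [0, c·d) consists of c blocks, each congruent to [0, d) modulo d.
  powerSum-periodic : ∀ K c d → powerSum K (c ℕ.* d) ≋ + c * powerSum K d mod + d
  powerSum-periodic K c d = begin
    powerSum K (c ℕ.* d)                                   ≡⟨ ∑-blocks (λ j → (+ j) ^ K) c d ⟩
    (∑[ t < c ] ∑[ u < d ] (+ (t ℕ.* d ℕ.+ u)) ^ K)        ≈⟨ ∑-cong c (λ t _ → ∑-cong d (λ u _ → ≋-^ K (block t u))) ⟩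
    (∑[ t < c ] powerSum K d)                              ≡⟨ ∑-const (powerSum K d) c ⟩
    + c * powerSum K d                                     ∎
    where
    open ≋-Reasoning (+ d)
    block : ∀ t u → + (t ℕ.* d ℕ.+ u) ≋ + u mod + d
    block t u = ≋-trans (≡⇒≋ (pos-block t d u)) (≋-multiple (+ u) (+ t))

  binomial-mod-square : ∀ a c k → (a + c) ^ suc k ≋ a ^ suc k + + suc k * c * a ^ k mod c * c
  binomial-mod-square a c zero = ≡⇒≋ (identity a c)
    where
    identity : ∀ a c → (a + c) * 1ℤ ≡ a * 1ℤ + 1ℤ * c * 1ℤ
    identity = solve-∀
  binomial-mod-square a c (suc k) = begin
    (a + c) * (a + c) ^ suc k
      ≈⟨ ≋-* (≋-refl (a + c)) (binomial-mod-square a c k) ⟩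
    (a + c) * (a ^ suc k + + suc k * c * a ^ k)
      ≡⟨ expand a c (a ^ k) (+ suc k) ⟩
    (a ^ suc (suc k) + + suc (suc k) * c * a ^ suc k) + (+ suc k * a ^ k) * (c * c)
      ≈⟨ ≋-multiple _ (+ suc k * a ^ k) ⟩
    a ^ suc (suc k) + + suc (suc k) * c * a ^ suc k
      ∎
    where
    open ≋-Reasoning (c * c)
    expand : ∀ a c w s → (a + c) * (a * w + s * c * w) ≡
             (a * (a * w) + (1ℤ + s) * c * (a * w)) + (s * w) * (c * c)
    expand = solve-∀

  -- Expanding (t·M + u)^K modulo M² leaves a correction proportional
  -- to ∑_{t < p} t = p·h, which vanishes modulo p·M.
  powerSum-lift : ∀ h k M → suc (2 ℕ.* h) ∣ M →
    powerSum (suc k) (suc (2 ℕ.* h) ℕ.* M) ≋ + suc (2 ℕ.* h) * powerSum (suc k) M mod + suc (2 ℕ.* h) * + M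
  powerSum-lift h k M (divides s M≡s*p) = begin
    powerSum K (p ℕ.* M)                                 ≡⟨ ∑-blocks (λ j → (+ j) ^ K) p M ⟩
    (∑[ t < p ] ∑[ u < M ] (+ (t ℕ.* M ℕ.+ u)) ^ K)      ≈⟨ ≋-weaken (≋-modulus M²≡pMs (∑-cong p (λ t _ → block t))) ⟩
    (∑[ t < p ] (powerSum K M + W * + t))                ≡⟨ outer ⟩
    + p * powerSum K M + W * (+ p * + h)                 ≡⟨ regroup (+ p * powerSum K M) (powerSum k M) (+ K) (+ M) (+ p) (+ h) ⟩
    + p * powerSum K M + (+ K * powerSum k M * + h) * (+ p * + M)
                                                         ≈⟨ ≋-multiple (+ p * powerSum K M) (+ K * powerSum k M * + h) ⟩
    + p * powerSum K M                                   ∎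
    where
    p : ℕ
    p = suc (2 ℕ.* h)
    K : ℕ
    K = suc k
    open ≋-Reasoning (+ p * + M)
    -- the first-order correction contributed by one block
    W : ℤ
    W = + K * powerSum k M * + M
    M²≡pMs : + M * + M ≡ (+ p * + M) * + s
    M²≡pMs = trans (cong (λ v → + M * + v) M≡s*p)
               (trans (cong (_*_ (+ M)) (pos-* s p)) (rearrange (+ M) (+ s) (+ p)))
      where
      rearrange : ∀ M s p → M * (s * p) ≡ (p * M) * s
      rearrange = solve-∀
    term : ∀ t u → (+ (t ℕ.* M ℕ.+ u)) ^ K ≋ (+ u) ^ K + (+ K * (+ t * + M)) * (+ u) ^ k mod + M * + M
    term t u = ≋-trans (≡⇒≋ (cong (_^ K) (pos-block t M u)))
      (≋-trans (≋-weaken (≋-modulus (square (+ t) (+ M)) (binomial-mod-square (+ u) (+ t * + M) k)))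
               (≡⇒≋ (cong (_+_ ((+ u) ^ K)) (reassoc (+ K) (+ t * + M) ((+ u) ^ k)))))
      where
      square : ∀ t M → (t * M) * (t * M) ≡ (M * M) * (t * t)
      square = solve-∀
      reassoc : ∀ a b c → a * b * c ≡ (a * b) * c
      reassoc = solve-∀
    block : ∀ t → (∑[ u < M ] (+ (t ℕ.* M ℕ.+ u)) ^ K) ≋ powerSum K M + W * + t mod + M * + M
    block t = ≋-trans (∑-cong M (λ u _ → term t u)) (≡⇒≋ block-sum)
      where
      block-sum : (∑[ u < M ] ((+ u) ^ K + (+ K * (+ t * + M)) * (+ u) ^ k)) ≡ powerSum K M + W * + t
      block-sum = trans (∑-+ (λ u → (+ u) ^ K) (λ u → (+ K * (+ t * + M)) * (+ u) ^ k) M)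
        (cong (_+_ (powerSum K M)) (trans (∑-scale (+ K * (+ t * + M)) (λ u → (+ u) ^ k) M)
                                          (rearrange (+ K) (+ t) (+ M) (powerSum k M))))
        where
        rearrange : ∀ K t M S → (K * (t * M)) * S ≡ (K * S * M) * t
        rearrange = solve-∀
    outer : (∑[ t < p ] (powerSum K M + W * + t)) ≡ + p * powerSum K M + W * (+ p * + h)
    outer = trans (∑-+ (λ _ → powerSum K M) (λ t → W * + t) p)
      (cong₂ _+_ (∑-const (powerSum K M) p) (trans (∑-scale W (λ t → + t) p) (cong (_*_ W) (∑-odd-range h))))
    regroup : ∀ a S K M p h → a + (K * S * M) * (p * h) ≡ a + (K * S * h) * (p * M)
    regroup = solve-∀

  powerSum-primePower : ∀ h k e → let p = suc (2 ℕ.* h) in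
    powerSum (suc k) (p ℕ.^ suc e) ≋ + (p ℕ.^ e) * powerSum (suc k) p mod + (p ℕ.^ suc e)
  powerSum-primePower h k zero =
    ≡⇒≋ (trans (cong (powerSum (suc k)) (ℕₚ.*-identityʳ (suc (2 ℕ.* h)))) (sym (*-identityˡ (powerSum (suc k) (suc (2 ℕ.* h))))))
  powerSum-primePower h k (suc e) = ≋-modulus (sym (pos-* p (p ℕ.^ suc e))) (begin
    powerSum K (p ℕ.* p ℕ.^ suc e)         ≈⟨ powerSum-lift h k (p ℕ.^ suc e) (divides (p ℕ.^ e) (ℕₚ.*-comm p (p ℕ.^ e))) ⟩
    + p * powerSum K (p ℕ.^ suc e)          ≈⟨ ≋-scale (+ p) (powerSum-primePower h k e) ⟩
    + p * (+ (p ℕ.^ e) * powerSum K p)      ≡⟨ *-assoc (+ p) (+ (p ℕ.^ e)) (powerSum K p) ⟨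
    + p * + (p ℕ.^ e) * powerSum K p        ≡⟨ cong (_* powerSum K p) (pos-* p (p ℕ.^ e)) ⟨
    + (p ℕ.^ suc e) * powerSum K p          ∎)
    where
    p : ℕ
    p = suc (2 ℕ.* h)
    K : ℕ
    K = suc k
    open ≋-Reasoning (+ p * + (p ℕ.^ suc e))

  powerSum-local : ∀ h k e c → let p = suc (2 ℕ.* h) in
    powerSum (suc k) (c ℕ.* p ℕ.^ suc e) ≋ + c * (+ (p ℕ.^ e) * powerSum (suc k) p) mod + (p ℕ.^ suc e)
  powerSum-local h k e c = ≋-trans (powerSum-periodic (suc k) c (suc (2 ℕ.* h) ℕ.^ suc e)) (≋-* (≋-refl (+ c)) (powerSum-primePower h k e))

  primePower∣powerSum : ∀ h k e c → let p = suc (2 ℕ.* h) in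
    Prime p → ¬ (2 ℕ.* h) ∣ suc k → p ℕ.^ suc e ∣ℤ powerSum (suc k) (c ℕ.* p ℕ.^ suc e)
  primePower∣powerSum h k e c pr p-1∤K = ≋-trans (powerSum-local h k e c) (∣ℤ-*ˡ (+ c) p^[e+1]∣p^eS)
    where
    p : ℕ
    p = suc (2 ℕ.* h)
    p^[e+1]∣p^eS : p ℕ.^ suc e ∣ℤ + (p ℕ.^ e) * powerSum (suc k) p
    p^[e+1]∣p^eS = ≋-modulus (trans (sym (pos-* (p ℕ.^ e) p)) (cong +_ (ℕₚ.*-comm (p ℕ.^ e) p)))
      (≋-trans (≋-scale (+ (p ℕ.^ e)) (powerSum-prime-generic k pr p-1∤K)) (≡⇒≋ (*-zeroʳ (+ (p ℕ.^ e)))))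

  -- If (p - 1) ∣ K and n = c · p^(e+1) with p ∤ c, then p^(e+1) ∤ S_K(n), since
  -- S_K(n) ≡ c · p^e · (p - 1)  (mod p^(e+1)).
  primePower∤powerSum : ∀ h k e c → let p = suc (2 ℕ.* h) in
    Prime p → (2 ℕ.* h) ∣ suc k → ¬ p ∣ c → ¬ p ℕ.^ suc e ∣ℤ powerSum (suc k) (c ℕ.* p ℕ.^ suc e)
  primePower∤powerSum zero k e c () _ _ _
  primePower∤powerSum h@(suc _) k e c pr (divides q K≡q*2h) p∤c p^[e+1]∣S =
    [ p∤c , >⇒∤ ℕₚ.≤-refl ]′ (euclidsLemma c (2 ℕ.* h) pr p∣c*2h)
    where
    p : ℕ
    p = suc (2 ℕ.* h)
    instance _ = ℕₚ.m^n≢0 p e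
    residue : + (c ℕ.* (p ℕ.^ e ℕ.* (2 ℕ.* h))) ≋ 0ℤ mod + (p ℕ.^ suc e)
    residue = begin
      + (c ℕ.* (p ℕ.^ e ℕ.* (2 ℕ.* h)))                   ≡⟨ trans (pos-* c (p ℕ.^ e ℕ.* (2 ℕ.* h))) (cong (_*_ (+ c)) (pos-* (p ℕ.^ e) (2 ℕ.* h))) ⟩
      + c * (+ (p ℕ.^ e) * + (2 ℕ.* h))                   ≈⟨ ≋-* (≋-refl (+ c)) (≋-modulus p^e*p≡p^[e+1] (≋-scale (+ (p ℕ.^ e))
                                                               (powerSum-prime-exceptional q k pr K≡q*2h))) ⟨
      + c * (+ (p ℕ.^ e) * powerSum (suc k) p)            ≈⟨ powerSum-local h k e c ⟨
      powerSum (suc k) (c ℕ.* p ℕ.^ suc e)                ≈⟨ p^[e+1]∣S ⟩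
      0ℤ                                                  ∎
      where
      open ≋-Reasoning (+ (p ℕ.^ suc e))
      p^e*p≡p^[e+1] : + (p ℕ.^ e) * + p ≡ + (p ℕ.^ suc e)
      p^e*p≡p^[e+1] = trans (sym (pos-* (p ℕ.^ e) p)) (cong +_ (ℕₚ.*-comm (p ℕ.^ e) p))
    p∣c*2h : p ∣ c ℕ.* (2 ℕ.* h)
    p∣c*2h = *-cancelˡ-∣ (p ℕ.^ e)
      (subst₂ _∣_ (ℕₚ.*-comm p (p ℕ.^ e)) (ℕ-rearrange c (p ℕ.^ e) (2 ℕ.* h)) (∣ℤ⇒∣ residue))
      where
      ℕ-rearrange : ∀ c a b → c ℕ.* (a ℕ.* b) ≡ a ℕ.* (c ℕ.* b)
      ℕ-rearrange = ℕ-solve-∀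

  -- For n = 2K + 1 with K > 0, G(n) is the power sum S_K(n): the exponent (n - 1)/2 is K,
  -- and the j = 0 term 0^K missing from G vanishes.
  G≡powerSum : ∀ k → let n = suc (2 ℕ.* suc k) in + G n ≡ powerSum (suc k) n
  G≡powerSum k = begin
    + sum (map (λ j → suc j ℕ.^ ((n ℕ.∸ 1) / 2)) (applyUpTo (λ j → j) (n ℕ.∸ 1)))
      ≡⟨ cong (λ e → + sum (map (λ j → suc j ℕ.^ e) (applyUpTo (λ j → j) (n ℕ.∸ 1)))) half ⟩
    + sum (map (λ j → suc j ℕ.^ suc k) (applyUpTo (λ j → j) (n ℕ.∸ 1)))
      ≡⟨ sum-applyUpTo (λ j → suc j ℕ.^ suc k) (λ j → j) (n ℕ.∸ 1) ⟩
    (∑[ j < n ℕ.∸ 1 ] + (suc j ℕ.^ suc k))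
      ≡⟨ ∑-ext (n ℕ.∸ 1) (λ j _ → pos-^ (suc j) (suc k)) ⟩
    (∑[ j < n ℕ.∸ 1 ] (+ suc j) ^ suc k)
      ≡⟨ trans (∑-head (λ j → (+ j) ^ suc k) (n ℕ.∸ 1)) (+-identityˡ _) ⟨
    powerSum (suc k) n
      ∎
    where
    open ≡-Reasoning
    n : ℕ
    n = suc (2 ℕ.* suc k)
    half : (n ℕ.∸ 1) / 2 ≡ suc k
    half = trans (cong (_/ 2) (ℕₚ.*-comm 2 (suc k))) (m*n/n≡m (suc k) 2)
    pos-^ : ∀ x e → + (x ℕ.^ e) ≡ (+ x) ^ e
    pos-^ x zero = refl
    pos-^ x (suc e) = trans (pos-* x (x ℕ.^ e)) (cong (_*_ (+ x)) (pos-^ x e))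

  primePower∣G : ∀ h k e c → let p = suc (2 ℕ.* h) ; n = suc (2 ℕ.* suc k) in
    Prime p → ¬ (2 ℕ.* h) ∣ suc k → n ≡ c ℕ.* p ℕ.^ suc e → p ℕ.^ suc e ∣ G n
  primePower∣G h k e c pr p-1∤K n≡cp^[e+1] = ∣ℤ⇒∣ (≋-trans (≡⇒≋ (G≡powerSum k))
    (subst (λ m → suc (2 ℕ.* h) ℕ.^ suc e ∣ℤ powerSum (suc k) m) (sym n≡cp^[e+1]) (primePower∣powerSum h k e c pr p-1∤K)))

  primePower∤G : ∀ h k e c → let p = suc (2 ℕ.* h) ; n = suc (2 ℕ.* suc k) in
    Prime p → (2 ℕ.* h) ∣ suc k → ¬ p ∣ c → n ≡ c ℕ.* p ℕ.^ suc e → ¬ p ℕ.^ suc e ∣ G n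
  primePower∤G h k e c pr p-1∣K p∤c n≡cp^[e+1] p^[e+1]∣G = primePower∤powerSum h k e c pr p-1∣K p∤c
    (≋-trans (≡⇒≋ (sym (trans (G≡powerSum k) (cong (powerSum (suc k)) n≡cp^[e+1]))))
             (∣⇒∣ℤ (+ G (suc (2 ℕ.* suc k))) p^[e+1]∣G))

-- Arithmetic on ℕ is opened only now: inside PowerSums the same operator names denote ℤ.
open import Data.Nat using (zero; suc; _+_; _*_; _∸_; _^_; _<_; s≤s; z≤n; nonTrivial⇒n>1; >-nonZero)
import Data.Nat.Properties as ℕₚ
open import Data.Nat.Divisibility
  using (_∣_; divides; _∣?_; ∣-trans; 1∣_; ∣⇒≤; >⇒∤; *-monoʳ-∣; *-cancelˡ-∣; ∣m+n∣m⇒∣n; m∣m*n)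
open import Data.Nat.DivMod using (_%_; [m+kn]%n≡m%n; m*n%n≡0)
open import Data.Nat.Primality using (euclidsLemma; prime?; prime⇒irreducible; prime⇒nonZero; prime⇒nonTrivial)
open import Data.Nat.Primality.Factorisation using (factorise)
open import Data.Nat.ListAction using (product)
open import Data.List.Relation.Unary.All using (_∷_)
open import Data.List using ([]; _∷_)
open import Data.Nat.Induction using (<-rec)
open import Data.Nat.Tactic.RingSolver using (solve-∀)
open import Relation.Nullary using (yes; no)
open import Relation.Nullary.Decidable using (_×-dec_)
open import Function.Bundles using (mk⇔)
open PowerSums using (primePower∣G; primePower∤G)

prime>1 : ∀ {p} → Prime p → 1 < p
prime>1 {p} pr = nonTrivial⇒n>1 p {{prime⇒nonTrivial pr}}

prime-factor : ∀ n → 1 < n → ∃[ P ] (Prime P × P ∣ n)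
prime-factor n@(suc _) 1<n with factorise n
... | record { factors = [] ; isFactorisation = n≡1 } = ⊥-elim (ℕₚ.<-irrefl (sym n≡1) 1<n)
... | record { factors = P ∷ Ps ; isFactorisation = n≡P*Ps ; factorsPrime = P-prime ∷ _ } =
  P , P-prime , divides (product Ps) (trans n≡P*Ps (ℕₚ.*-comm P (product Ps)))

positive-factor : ∀ m n → 0 < m * n → 0 < m
positive-factor (suc m) n _ = s≤s z≤n

primePower-cancel : ∀ {P} k c y → Prime P → ¬ P ∣ c → P ^ k ∣ c * y → P ^ k ∣ y
primePower-cancel zero c y pr P∤c _ = 1∣ y
primePower-cancel {P} (suc k) c y pr P∤c P^[k+1]∣cy
  with euclidsLemma c y pr (∣-trans (m∣m*n (P ^ k)) P^[k+1]∣cy)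
... | inj₁ P∣c = ⊥-elim (P∤c P∣c)
... | inj₂ (divides y′ refl) =
  subst (P * P ^ k ∣_) (ℕₚ.*-comm P y′) (*-monoʳ-∣ P (primePower-cancel k c y′ pr P∤c P^k∣cy′))
  where
  instance _ = prime⇒nonZero pr
  P^k∣cy′ : P ^ k ∣ c * y′
  P^k∣cy′ = *-cancelˡ-∣ P (subst (P * P ^ k ∣_) (rearrange c y′ P) P^[k+1]∣cy)
    where
    rearrange : ∀ c y P → c * (y * P) ≡ P * (c * y)
    rearrange = solve-∀

PrimeSplit : ℕ → ℕ → Set
PrimeSplit P n = ∃[ e ] ∃[ c ] (n ≡ c * P ^ suc e × ¬ P ∣ c)

split-prime : ∀ {P} n → Prime P → 0 < n → P ∣ n → PrimeSplit P n
split-prime {P} n pr = <-rec (λ n → 0 < n → P ∣ n → PrimeSplit P n) step n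
  where
  instance _ = prime⇒nonZero pr
  step : ∀ n → (∀ {m} → m < n → 0 < m → P ∣ m → PrimeSplit P m) → 0 < n → P ∣ n → PrimeSplit P n
  step .(m * P) rec 0<mP (divides m refl) with P ∣? m
  ... | no P∤m = 0 , m , cong (m *_) (sym (ℕₚ.*-identityʳ P)) , P∤m
  ... | yes P∣m
    with rec (ℕₚ.m<m*n m P {{>-nonZero (positive-factor m P 0<mP)}} (prime>1 pr)) (positive-factor m P 0<mP) P∣m
  ...   | e , c , m≡cP^[e+1] , P∤c = suc e , c , trans (cong (_* P) m≡cP^[e+1]) (rearrange c P (P ^ suc e)) , P∤c
    where
    rearrange : ∀ c P Q → c * Q * P ≡ c * (P * Q)
    rearrange = solve-∀

combine : ∀ {P} k c X → Prime P → ¬ P ∣ c → c ∣ X → P ^ k ∣ X → c * P ^ k ∣ X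
combine {P} k c .(x * c) pr P∤c (divides x refl) P^k∣xc =
  subst (c * P ^ k ∣_) (ℕₚ.*-comm c x)
    (*-monoʳ-∣ c (primePower-cancel k c x pr P∤c (subst (P ^ k ∣_) (ℕₚ.*-comm x c) P^k∣xc)))

PrimePowersDivide : ℕ → ℕ → Set
PrimePowersDivide n X = ∀ P e → Prime P → P ^ suc e ∣ n → P ^ suc e ∣ X

-- Strong induction on n: split off the full power of one prime factor P, n = c · P^(e+1);
-- then c ∣ X by induction and P^(e+1) ∣ X by hypothesis.
local-to-global : ∀ n X → 0 < n → PrimePowersDivide n X → n ∣ X
local-to-global n X = <-rec (λ n → 0 < n → PrimePowersDivide n X → n ∣ X) step n
  where
  step : ∀ n → (∀ {m} → m < n → 0 < m → PrimePowersDivide m X → m ∣ X) →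
         0 < n → PrimePowersDivide n X → n ∣ X
  step (suc zero) _ _ _ = 1∣ X
  step n@(suc (suc _)) rec _ local with prime-factor n (s≤s (s≤s z≤n))
  ... | P , pr , P∣n with split-prime n pr (s≤s z≤n) P∣n
  ...   | e , c , n≡cQ , P∤c =
    subst (_∣ X) (sym n≡cQ) (combine (suc e) c X pr P∤c c∣X (local P e pr (divides c n≡cQ)))
    where
    instance _ = prime⇒nonZero pr
    instance _ = ℕₚ.m^n≢0 P e
    0<c : 0 < c
    0<c = positive-factor c (P ^ suc e) (subst (0 <_) n≡cQ (s≤s z≤n))
    c∣n : c ∣ n
    c∣n = divides (P ^ suc e) (trans n≡cQ (ℕₚ.*-comm c (P ^ suc e)))
    c<n : c < n
    c<n = subst (c <_) (sym n≡cQ)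
            (ℕₚ.m<m*n c (P ^ suc e) {{>-nonZero 0<c}} (ℕₚ.<-≤-trans (prime>1 pr) (ℕₚ.m≤m*n P (P ^ e))))
    c∣X : c ∣ X
    c∣X = rec c<n 0<c (λ P′ e′ pr′ P′^[e′+1]∣c → local P′ e′ pr′ (∣-trans P′^[e′+1]∣c c∣n))

parity : ∀ m → ∃[ h ] (m ≡ 2 * h ⊎ m ≡ suc (2 * h))
parity zero = 0 , inj₁ refl
parity (suc m) with parity m
... | h , inj₁ refl = h , inj₂ refl
... | h , inj₂ refl = suc h , inj₁ (cong suc (sym (ℕₚ.+-suc h (h + 0))))

odd%2 : ∀ K → suc (2 * K) % 2 ≡ 1
odd%2 K = trans (cong (λ m → suc m % 2) (ℕₚ.*-comm 2 K)) ([m+kn]%n≡m%n 1 K 2)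

even%2 : ∀ h → (2 * h) % 2 ≡ 0
even%2 h = trans (cong (_% 2) (ℕₚ.*-comm 2 h)) (m*n%n≡0 h 2)

odd-form : ∀ n → Odd n → ∃[ K ] n ≡ suc (2 * K)
odd-form n odd with parity n
... | h , inj₁ refl = ⊥-elim (ℕₚ.0≢1+n (trans (sym (even%2 h)) odd))
... | K , inj₂ n≡2K+1 = K , n≡2K+1

2∤odd : ∀ K → ¬ 2 ∣ suc (2 * K)
2∤odd K (divides q 2K+1≡2q) = ℕₚ.1+n≢0 (trans (sym (odd%2 K)) (trans (cong (_% 2) 2K+1≡2q) (m*n%n≡0 q 2)))

odd-divisor : ∀ K P → P ∣ suc (2 * K) → ∃[ h ] P ≡ suc (2 * h)
odd-divisor K P P∣n with parity P
... | h , inj₂ P≡2h+1 = h , P≡2h+1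
... | h , inj₁ refl = ⊥-elim (2∤odd K (∣-trans (divides h (ℕₚ.*-comm 2 h)) P∣n))

odd-prime-half : ∀ h → Prime (suc (2 * h)) → 0 < h
odd-prime-half zero ()
odd-prime-half (suc h) _ = s≤s z≤n

F⇒witness : ∀ h n → let p = suc (2 * h) in
  n ≡ p * p [mod 2 * p * (p ∸ 1) ] → ∃[ K ] (n ≡ suc (2 * K) × p ∣ n × 2 * h ∣ K)
F⇒witness h n (inj₂ (c , p²+cM≡n)) =
  K , trans (sym p²+cM≡n) (odd-shape h c) , divides (p + 4 * h * c) (trans (sym p²+cM≡n) (p-multiple h c)) ,
  divides (h + 1 + c * p) (ℕₚ.*-comm (2 * h) (h + 1 + c * p))
  where
  p : ℕ
  p = suc (2 * h)
  K : ℕ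
  K = 2 * h * (h + 1 + c * p)
  odd-shape : ∀ h c → suc (2 * h) * suc (2 * h) + c * (2 * suc (2 * h) * (2 * h)) ≡ suc (2 * (2 * h * (h + 1 + c * suc (2 * h))))
  odd-shape = solve-∀
  p-multiple : ∀ h c → suc (2 * h) * suc (2 * h) + c * (2 * suc (2 * h) * (2 * h)) ≡ (suc (2 * h) + 4 * h * c) * suc (2 * h)
  p-multiple = solve-∀
F⇒witness h n (inj₁ (c , n+cM≡p²)) with parity n
... | K , inj₁ refl = ⊥-elim (2∤odd (2 * h * (h + 1)) (divides (K + c * (suc (2 * h) * (2 * h)))
        (trans (sym (p²-odd h)) (trans (sym n+cM≡p²) (even-shape K h c)))))
  where
  p²-odd : ∀ h → suc (2 * h) * suc (2 * h) ≡ suc (2 * (2 * h * (h + 1)))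
  p²-odd = solve-∀
  even-shape : ∀ K h c → 2 * K + c * (2 * suc (2 * h) * (2 * h)) ≡ (K + c * (suc (2 * h) * (2 * h))) * 2
  even-shape = solve-∀
... | K , inj₂ refl = K , refl , p∣n , 2h∣K
  where
  p : ℕ
  p = suc (2 * h)
  p∣n : p ∣ suc (2 * K)
  p∣n = ∣m+n∣m⇒∣n (subst (p ∣_) (ℕₚ.+-comm (suc (2 * K)) _) (divides p n+cM≡p²))
                   (divides (c * 2 * (2 * h)) (rearrange h c))
    where
    rearrange : ∀ h c → c * (2 * suc (2 * h) * (2 * h)) ≡ c * 2 * (2 * h) * suc (2 * h)
    rearrange = solve-∀
  halved : c * (2 * h * p) + K ≡ 2 * h * (h + 1)
  halved = ℕₚ.*-cancelˡ-≡ _ _ 2 (ℕₚ.suc-injective (trans (lhs K c h) (trans n+cM≡p² (rhs h))))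
    where
    lhs : ∀ K c h → suc (2 * (c * (2 * h * suc (2 * h)) + K)) ≡ suc (2 * K) + c * (2 * suc (2 * h) * (2 * h))
    lhs = solve-∀
    rhs : ∀ h → suc (2 * h) * suc (2 * h) ≡ suc (2 * (2 * h * (h + 1)))
    rhs = solve-∀
  2h∣K : 2 * h ∣ K
  2h∣K = ∣m+n∣m⇒∣n (subst (2 * h ∣_) (sym halved) (m∣m*n (h + 1)))
                    (divides (c * p) (rearrange c h))
    where
    rearrange : ∀ c h → c * (2 * h * suc (2 * h)) ≡ c * suc (2 * h) * (2 * h)
    rearrange = solve-∀

-- Conversely, n = 2K + 1 with p ∣ n and (p - 1) ∣ K lies in the class of p² modulo 2p(p - 1):
-- writing n = (2g + 1)·p, comparing with n = 1 + 4h·b forces g = h + 2h·c, so n = p² + c·2p(p - 1).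
witness⇒F : ∀ h K → let p = suc (2 * h) in
  0 < h → p ∣ suc (2 * K) → 2 * h ∣ K → suc (2 * K) ≡ p * p [mod 2 * p * (p ∸ 1) ]
witness⇒F h K 0<h (divides a n≡ap) (divides b K≡b2h) with parity a
... | g , inj₁ refl = ⊥-elim (2∤odd K (divides (g * suc (2 * h)) (trans n≡ap (rearrange g h))))
  where
  rearrange : ∀ g h → 2 * g * suc (2 * h) ≡ g * suc (2 * h) * 2
  rearrange = solve-∀
... | g , inj₂ refl with 2h∣g+h
  where
  p : ℕ
  p = suc (2 * h)
  -- (2g + 1)(2h + 1) = 4hb + 1 gives  b · 2h = (g + h) + g · 2h
  b2h≡g+h+g2h : b * (2 * h) ≡ (g + h) + g * (2 * h)
  b2h≡g+h+g2h = ℕₚ.*-cancelˡ-≡ _ _ 2 (ℕₚ.suc-injective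
    (trans (cong (λ k → suc (2 * k)) (sym K≡b2h)) (trans n≡ap (expand g h))))
    where
    expand : ∀ g h → suc (2 * g) * suc (2 * h) ≡ suc (2 * ((g + h) + g * (2 * h)))
    expand = solve-∀
  2h∣g+h : 2 * h ∣ g + h
  2h∣g+h = ∣m+n∣m⇒∣n (subst (2 * h ∣_) (sym (trans (ℕₚ.+-comm (g * (2 * h)) (g + h)) (sym b2h≡g+h+g2h))) (divides b refl)) (divides g refl)
... | divides zero g+h≡0 = ⊥-elim (ℕₚ.<-irrefl refl (ℕₚ.<-≤-trans 0<h (subst (h ≤_) g+h≡0 (ℕₚ.m≤n+m h g))))
... | divides (suc c) g+h≡2h+c2h = inj₂ (c , trans (shape h c) (sym (trans n≡ap (cong (λ g → suc (2 * g) * suc (2 * h)) g≡h+c2h))))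
  where
  g≡h+c2h : g ≡ h + c * (2 * h)
  g≡h+c2h = ℕₚ.+-cancelʳ-≡ h g (h + c * (2 * h)) (trans g+h≡2h+c2h (rearrange h c))
    where
    rearrange : ∀ h c → suc c * (2 * h) ≡ h + c * (2 * h) + h
    rearrange = solve-∀
  shape : ∀ h c → suc (2 * h) * suc (2 * h) + c * (2 * suc (2 * h) * (2 * h)) ≡ suc (2 * (h + c * (2 * h))) * suc (2 * h)
  shape = solve-∀

odd-prime : ∀ {p} → Prime p → 3 ≤ p → ∃[ h ] p ≡ suc (2 * h)
odd-prime {p} pr 3≤p with parity p
... | h , inj₂ p≡2h+1 = h , p≡2h+1
... | h , inj₁ refl with prime⇒irreducible pr (divides h (ℕₚ.*-comm 2 h))
...   | inj₁ ()
...   | inj₂ 2≡p = ⊥-elim (ℕₚ.<-irrefl 2≡p 3≤p)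

module _ (k : ℕ) where

  private
    n : ℕ
    n = suc (2 * suc k)

  -- A witness prime forces n ∤ G(n): the full power of p in n already fails to divide G(n).
  witness⇒∤G : ∀ h → Prime (suc (2 * h)) → suc (2 * h) ∣ n → 2 * h ∣ suc k → ¬ n ∣ G n
  witness⇒∤G h pr p∣n p-1∣K n∣G with split-prime n pr (s≤s z≤n) p∣n
  ... | e , c , n≡cQ , p∤c = primePower∤G h k e c pr p-1∣K p∤c n≡cQ (∣-trans (divides c n≡cQ) n∣G)

  noWitness⇒∣G : (∀ h → Prime (suc (2 * h)) → suc (2 * h) ∣ n → ¬ 2 * h ∣ suc k) → n ∣ G n
  noWitness⇒∣G none = local-to-global n (G n) (s≤s z≤n) primePower∣n⇒∣G
    where
    primePower∣n⇒∣G : PrimePowersDivide n (G n)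
    primePower∣n⇒∣G P e pr (divides c n≡cQ) = from-odd (odd-divisor (suc k) P P∣n) P∣n
      where
      P∣n : P ∣ n
      P∣n = ∣-trans (m∣m*n (P ^ e)) (divides c n≡cQ)
      from-odd : ∃[ h ] P ≡ suc (2 * h) → P ∣ n → P ^ suc e ∣ G n
      from-odd (h , refl) P∣n = primePower∣G h k e c pr (none h pr P∣n) n≡cQ

  ∤G⇒witness : ¬ n ∣ G n → ∃[ p ] (Prime p × p ∣ n × (p ∸ 1) ∣ suc k)
  ∤G⇒witness n∤G with ℕₚ.anyUpTo? (λ p → prime? p ×-dec p ∣? n ×-dec (p ∸ 1) ∣? suc k) (suc n)
  ... | yes (p , _ , witness) = p , witness
  ... | no none = ⊥-elim (n∤G (noWitness⇒∣G λ h pr p∣n p-1∣K →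
                    none (suc (2 * h) , s≤s (∣⇒≤ p∣n) , pr , p∣n , p-1∣K)))

mainTheorem10 : ∀ (n : ℕ) →
    (InI n × ¬ InP n) ⇔ (∃[ p ] (Prime p × 3 ≤ p × InF p n))
mainTheorem10 n = mk⇔ to from
  where
  to : InI n × ¬ InP n → ∃[ p ] (Prime p × 3 ≤ p × InF p n)
  to ((odd , 0<n) , n∉𝔓) with odd-form n odd
  ... | zero , refl = ⊥-elim (n∉𝔓 (odd , 0<n , 1∣ G 1))
  ... | suc k , refl with ∤G⇒witness k (λ n∣G → n∉𝔓 (odd , 0<n , n∣G))
  ...   | p , pr , p∣n , p-1∣K with odd-divisor (suc k) p p∣n
  ...     | h , refl = p , pr , s≤s (ℕₚ.*-monoʳ-≤ 2 0<h) , 0<n , witness⇒F h (suc k) 0<h p∣n p-1∣K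
    where
    0<h : 0 < h
    0<h = odd-prime-half h pr
  from : ∃[ p ] (Prime p × 3 ≤ p × InF p n) → InI n × ¬ InP n
  from (p , pr , 3≤p , 0<n , n∈𝓕) with odd-prime pr 3≤p
  ... | h , refl with F⇒witness h n n∈𝓕
  ...   | zero , refl , p∣1 , _ = ⊥-elim (>⇒∤ (ℕₚ.<-≤-trans (s≤s (s≤s z≤n)) 3≤p) p∣1)
  ...   | suc k , refl , p∣n , p-1∣K =
    (odd%2 (suc k) , 0<n) , λ (_ , _ , n∣G) → witness⇒∤G k h pr p∣n p-1∣K n∣G
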